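{- Let $G$ be a finite simple graph, $x$ a vertex of $G$, and $B_1,B_2\subseteq V(G)$ sets of vertices such that (i) $B_1\cap B_2\neq\emptyset$, (ii) $G[B_1\cup B_2]$ is a complete bipartite graph, and (iii) $G[B_1\cup\{x\}]$ and $G[B_2\cup\{x\}]$ are complete bipartite graphs. Then $G[B_1\cup B_2\cup\{x\}]$ is a complete bipartite graph. -}

module Defs where

open import Data.Nat using (ℕ)
open import Data.Fin using (Fin)
open import Data.Fin.Subset using (Subset; _∈_)
open import Data.Bool using (Bool)
open import Data.Product using (∃; _×_)
open import Relation.Nullary using (¬_; Dec)
open import Relation.Binary.PropositionalEquality using (_≡_; _≢_)

record SimpleGraph (n : ℕ) : Set₁ where
  field
    Adj    : Fin n → Fin n → Set
    adj?   : ∀ u v → Dec (Adj u v)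
    sym    : ∀ {u v} → Adj u v → Adj v u
    irrefl : ∀ {u} → ¬ Adj u u

open SimpleGraph public

IsCompleteBipartiteInduced : ∀ {n} → SimpleGraph n → Subset n → Set
IsCompleteBipartiteInduced {n} G S =
  ∃ λ (side : Fin n → Bool) →
    (∀ u v → u ∈ S → v ∈ S → side u ≡ side v → ¬ Adj G u v) ×
    (∀ u v → u ∈ S → v ∈ S → side u ≢ side v → Adj G u v)

-- Encode adjacency as a Boolean.  A side function s witnesses that G[S] is
-- complete bipartite exactly when adj u v = s u xor s v on S; in particular
-- adjacency along any three vertices of S satisfies adj u w = adj u v xor adj v w.
-- Fix c ∈ B₁ ∩ B₂ and sides s of G[B₁ ∪ B₂].  For u ∈ Bᵢ this identity in
-- G[Bᵢ ∪ {x}] gives adj x u = adj x c xor adj c u = (adj x c xor s c) xor s u, so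
-- putting x on the side adj x c xor s c extends s to G[B₁ ∪ B₂ ∪ {x}].
module Submission where

open import Defs hiding (sym)
open import Data.Nat using (ℕ)
open import Data.Fin using (Fin)
open import Data.Fin.Subset using (Subset; _∪_; _∩_; ⁅_⁆; Nonempty; _∈_; _∉_; _⊆_)
open import Data.Fin.Subset.Properties
  using (_∈?_; x∈p∪q⁻; x∈p∪q⁺; x∈p∩q⁻; p⊆p∪q; q⊆p∪q; x∈⁅x⁆; x∈⁅y⁆⇒x≡y)
open import Data.Bool using (Bool; true; false; _xor_; if_then_else_)
open import Data.Bool.Properties using (_≟_; xor-same; xor-assoc; xor-comm)
open import Data.Product using (_,_; proj₁)
open import Data.Sum using (inj₁; inj₂)
open import Relation.Nullary using (¬_; Dec; yes; no; does; contradiction)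
open import Relation.Nullary.Decidable using (dec-true; dec-false)
open import Relation.Binary.PropositionalEquality

xor-cancel-middle : ∀ a b c → (a xor b) xor (b xor c) ≡ a xor c
xor-cancel-middle a b c = begin
  (a xor b) xor (b xor c) ≡⟨ xor-assoc a b (b xor c) ⟩
  a xor (b xor (b xor c)) ≡⟨ cong (a xor_) (sym (xor-assoc b b c)) ⟩
  a xor ((b xor b) xor c) ≡⟨ cong (λ z → a xor (z xor c)) (xor-same b) ⟩
  a xor c                 ∎
  where open ≡-Reasoning

≡⇒xor≡false : ∀ {a b} → a ≡ b → a xor b ≡ false
≡⇒xor≡false {a} refl = xor-same a

≢⇒xor≡true : ∀ {a b} → a ≢ b → a xor b ≡ true
≢⇒xor≡true {false} {false} a≢b = contradiction refl a≢b
≢⇒xor≡true {false} {true}  _   = refl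
≢⇒xor≡true {true}  {false} _   = refl
≢⇒xor≡true {true}  {true}  a≢b = contradiction refl a≢b

does≡true⇒ : ∀ {p} {P : Set p} (P? : Dec P) → does P? ≡ true → P
does≡true⇒ (yes p) _ = p

does≡false⇒¬ : ∀ {p} {P : Set p} (P? : Dec P) → does P? ≡ false → ¬ P
does≡false⇒¬ (no ¬p) _ = ¬p

x∈p∪⁅y⁆⇒x∉p⇒x≡y : ∀ {n} {p : Subset n} {x y : Fin n} → x ∈ p ∪ ⁅ y ⁆ → x ∉ p → x ≡ y
x∈p∪⁅y⁆⇒x∉p⇒x≡y {p = p} {y = y} x∈p∪⁅y⁆ x∉p with x∈p∪q⁻ p ⁅ y ⁆ x∈p∪⁅y⁆
... | inj₁ x∈p   = contradiction x∈p x∉p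
... | inj₂ x∈⁅y⁆ = x∈⁅y⁆⇒x≡y y x∈⁅y⁆

extendSide : ∀ {n} → Subset n → (Fin n → Bool) → Bool → Fin n → Bool
extendSide S side a u = if does (u ∈? S) then side u else a

module _ {n : ℕ} (G : SimpleGraph n) where

  adj : Fin n → Fin n → Bool
  adj u v = does (adj? G u v)

  adj-sym : ∀ u v → adj u v ≡ adj v u
  adj-sym u v with adj? G v u
  ... | yes a = dec-true (adj? G u v) (SimpleGraph.sym G a)
  ... | no ¬a = dec-false (adj? G u v) (λ a → ¬a (SimpleGraph.sym G a))

  adj-irrefl : ∀ u → adj u u ≡ false
  adj-irrefl u = dec-false (adj? G u u) (irrefl G)

  BipartitionedBy : Subset n → (Fin n → Bool) → Set
  BipartitionedBy S side = ∀ {u v} → u ∈ S → v ∈ S → adj u v ≡ side u xor side v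

  completeBipartite⇒bipartitionedBy : ∀ {S} (cb : IsCompleteBipartiteInduced G S) →
    BipartitionedBy S (proj₁ cb)
  completeBipartite⇒bipartitionedBy (side , same⇒¬adj , differ⇒adj) {u} {v} u∈S v∈S
    with side u ≟ side v
  ... | yes same = trans (dec-false (adj? G u v) (same⇒¬adj u v u∈S v∈S same))
                         (sym (≡⇒xor≡false same))
  ... | no differ = trans (dec-true (adj? G u v) (differ⇒adj u v u∈S v∈S differ))
                          (sym (≢⇒xor≡true differ))

  bipartitionedBy⇒completeBipartite : ∀ {S} side → BipartitionedBy S side →
    IsCompleteBipartiteInduced G S
  bipartitionedBy⇒completeBipartite side bip =
      side
    , (λ u v u∈S v∈S same → does≡false⇒¬ (adj? G u v) (trans (bip u∈S v∈S) (≡⇒xor≡false same)))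
    , (λ u v u∈S v∈S differ → does≡true⇒ (adj? G u v) (trans (bip u∈S v∈S) (≢⇒xor≡true differ)))

  adj-cocycle : ∀ {S side u v w} → BipartitionedBy S side →
    u ∈ S → v ∈ S → w ∈ S → adj u w ≡ adj u v xor adj v w
  adj-cocycle {side = side} {u} {v} {w} bip u∈S v∈S w∈S = begin
    adj u w                                     ≡⟨ bip u∈S w∈S ⟩
    side u xor side w                           ≡⟨ sym (xor-cancel-middle (side u) (side v) (side w)) ⟩
    (side u xor side v) xor (side v xor side w) ≡⟨ sym (cong₂ _xor_ (bip u∈S v∈S) (bip v∈S w∈S)) ⟩
    adj u v xor adj v w                         ∎
    where open ≡-Reasoning

  adj-via-common-vertex : ∀ {S B side x c u} → BipartitionedBy S side → B ⊆ S →
    IsCompleteBipartiteInduced G (B ∪ ⁅ x ⁆) → c ∈ B → u ∈ B →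
    adj x u ≡ (adj x c xor side c) xor side u
  adj-via-common-vertex {B = B} {side} {x} {c} {u} bip B⊆S cb c∈B u∈B = begin
    adj x u                         ≡⟨ adj-cocycle {side = proj₁ cb} (completeBipartite⇒bipartitionedBy cb)
                                         x∈B∪⁅x⁆ (p⊆p∪q ⁅ x ⁆ c∈B) (p⊆p∪q ⁅ x ⁆ u∈B) ⟩
    adj x c xor adj c u             ≡⟨ cong (adj x c xor_) (bip (B⊆S c∈B) (B⊆S u∈B)) ⟩
    adj x c xor (side c xor side u) ≡⟨ sym (xor-assoc (adj x c) (side c) (side u)) ⟩
    (adj x c xor side c) xor side u ∎
    where
    open ≡-Reasoning
    x∈B∪⁅x⁆ : x ∈ B ∪ ⁅ x ⁆
    x∈B∪⁅x⁆ = x∈p∪q⁺ (inj₂ (x∈⁅x⁆ x))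

  bipartitionedBy-∪⁅⁆ : ∀ {S side x a} → BipartitionedBy S side →
    (∀ {u} → u ∈ S → adj x u ≡ a xor side u) →
    BipartitionedBy (S ∪ ⁅ x ⁆) (extendSide S side a)
  bipartitionedBy-∪⁅⁆ {S} {side} {x} {a} bip x-adj {u} {v} u∈S∪⁅x⁆ v∈S∪⁅x⁆
    with u ∈? S | v ∈? S
  ... | yes u∈S | yes v∈S = bip u∈S v∈S
  ... | yes u∈S | no v∉S rewrite x∈p∪⁅y⁆⇒x∉p⇒x≡y v∈S∪⁅x⁆ v∉S =
    trans (adj-sym u x) (trans (x-adj u∈S) (xor-comm a (side u)))
  ... | no u∉S | yes v∈S rewrite x∈p∪⁅y⁆⇒x∉p⇒x≡y u∈S∪⁅x⁆ u∉S = x-adj v∈S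
  ... | no u∉S | no v∉S
    rewrite x∈p∪⁅y⁆⇒x∉p⇒x≡y u∈S∪⁅x⁆ u∉S | x∈p∪⁅y⁆⇒x∉p⇒x≡y v∈S∪⁅x⁆ v∉S =
    trans (adj-irrefl x) (sym (xor-same a))

lemma10 : ∀ {n : ℕ} (G : SimpleGraph n) (x : Fin n) (B₁ B₂ : Subset n) →
    Nonempty (B₁ ∩ B₂) →
    IsCompleteBipartiteInduced G (B₁ ∪ B₂) →
    IsCompleteBipartiteInduced G (B₁ ∪ ⁅ x ⁆) →
    IsCompleteBipartiteInduced G (B₂ ∪ ⁅ x ⁆) →
    IsCompleteBipartiteInduced G ((B₁ ∪ B₂) ∪ ⁅ x ⁆)
lemma10 G x B₁ B₂ (c , c∈B₁∩B₂) cb cb₁ cb₂ =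
  bipartitionedBy⇒completeBipartite G (extendSide (B₁ ∪ B₂) side x-side)
    (bipartitionedBy-∪⁅⁆ G {side = side} bip x-adj)
  where
  side : Fin _ → Bool
  side = proj₁ cb

  bip : BipartitionedBy G (B₁ ∪ B₂) side
  bip = completeBipartite⇒bipartitionedBy G cb

  x-side : Bool
  x-side = adj G x c xor side c

  x-adj : ∀ {u} → u ∈ B₁ ∪ B₂ → adj G x u ≡ x-side xor side u
  x-adj u∈B₁∪B₂ with x∈p∩q⁻ B₁ B₂ c∈B₁∩B₂ | x∈p∪q⁻ B₁ B₂ u∈B₁∪B₂
  ... | c∈B₁ , _ | inj₁ u∈B₁ = adj-via-common-vertex G bip (p⊆p∪q B₂) cb₁ c∈B₁ u∈B₁
  ... | _ , c∈B₂ | inj₂ u∈B₂ = adj-via-common-vertex G bip (q⊆p∪q B₁ B₂) cb₂ c∈B₂ u∈B₂
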